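{- Let $A$ be a finite abelian group whose order is not a power of $2$, let $B$ be a subgroup of $A$ of index $2$, and let $H$ and $K$ be subgroups of $A$ with $1<H\le K<A$ and $H\le B$. Then the number of subsets $S\subseteq A\setminus B$ with $S=S^{ -1}$ and such that $S\setminus K$ is a union of cosets of $H$ is at most $2^{\frac{11|A|}{48}+\frac{|A_2\setminus B|}{2}}$.
   Context: $A_2:=\{a\in A\mid a^2=1\}$; $S^{ -1}:=\{s^{ -1}\mid s\in S\}$. -}

module Defs where

open import Data.Nat using (ℕ; _^_; _*_; _+_; _<_; _≤_)
open import Data.Fin using (Fin)
open import Data.Fin.Properties using (_≟_)
open import Data.Fin.Subset using (Subset; _∈_; _∉_; _⊆_; ∣_∣)
open import Data.Vec using (tabulate)
open import Data.Bool using (_∧_; not)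
open import Data.List using (List; length)
open import Data.List.Relation.Unary.All using (All)
open import Data.List.Relation.Unary.Unique.Propositional using (Unique)
open import Data.Product using (Σ; ∃; ∃-syntax; _×_)
open import Relation.Nullary using (¬_)
open import Relation.Nullary.Decidable using (⌊_⌋)
open import Relation.Binary.PropositionalEquality using (_≡_)
open import Function.Bundles using (_⇔_)
open import Algebra.Structures using (IsAbelianGroup)

record FinAbGroup (n : ℕ) : Set where
  field
    _∙_ : Fin n → Fin n → Fin n
    ε   : Fin n
    _⁻¹ : Fin n → Fin n
    isAbelianGroup : IsAbelianGroup _≡_ _∙_ ε _⁻¹
  infixl 7 _∙_
  infix 8 _⁻¹

module _ {n : ℕ} (G : FinAbGroup n) where
  open FinAbGroup G

  IsSubgroup : Subset n → Set
  IsSubgroup B = (ε ∈ B)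
               × (∀ x y → x ∈ B → y ∈ B → x ∙ y ∈ B)
               × (∀ x → x ∈ B → x ⁻¹ ∈ B)

  A₂∖ : Subset n → Subset n
  A₂∖ B = tabulate (λ a → ⌊ a ∙ a ≟ ε ⌋ ∧ not (Data.Vec.lookup B a))

  Symmetric : Subset n → Set
  Symmetric S = (∀ x → x ∈ S → x ⁻¹ ∈ S)
              × (∀ x → x ∈ S → ∃[ s ] (s ∈ S × x ≡ s ⁻¹))

  DiffIsUnionOfCosets : Subset n → Subset n → Subset n → Set
  DiffIsUnionOfCosets H S K =
    ∃[ T ] (∀ x → ((x ∈ S × x ∉ K) ⇔ (∃[ t ] ∃[ h ] (t ∈ T × h ∈ H × x ≡ t ∙ h))))

  Counted : (B H K S : Subset n) → Set
  Counted B H K S = (∀ x → x ∈ S → x ∉ B) × Symmetric S × DiffIsUnionOfCosets H S K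

module Submission where

-- A counted S is determined by its values on a set of representatives: on K ∖ B it is
-- closed under inversion, so one element of each pair {x, x⁻¹} suffices, and on A ∖ (B ∪ K)
-- it is moreover a union of H-cosets, so one element of each class xH ∪ x⁻¹H suffices.
-- Hence there are at most 2^r such S, r the number of representatives. A class xH ∪ x⁻¹H
-- has 2|H| elements unless x² ∈ H; with H trivial this gives 2r₁ ≤ |K ∖ B| + |A₂ ∩ K ∖ B|,
-- and |K ∖ B| ≤ n/4 as K is proper. For |H| ≥ 3 these bounds give 48r ≤ 11n + 24|A₂ ∖ B|.
-- For H = {1, h} the classes with x² = h are the obstacle: their elements are square roots
-- of h outside B, of which there are at most |B ∩ A₂|, and |B ∩ A₂| ≤ |B|/3 because B ∩ A₂
-- is an elementary abelian 2-group whose order divides |B| = n/2, not a power of 2.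

open import Algebra.Bundles using (AbelianGroup)
open import Algebra.Structures using (IsAbelianGroup)
import Algebra.Properties.AbelianGroup as AbelianGroupProperties
import Algebra.Properties.CommutativeSemigroup as CommutativeSemigroupProperties
open import Data.Bool using (Bool; true; false; _∧_; not)
open import Data.Empty using (⊥-elim)
open import Data.Fin using (Fin)
import Data.Fin as Fin
open import Data.Fin.Properties using (any?; all?; _≟_)
import Data.Fin.Properties as Finₚ
open import Data.Fin.Subset using (Subset; Side; inside; outside; _⊆_; ∣_∣; _∈_; _∉_)
open import Data.Fin.Subset.Properties using (_∈?_; ⊆-antisym; drop-there)
open import Data.List using (List; []; _∷_; length; map; filter; allFin; tabulate; cartesianProduct)
open import Data.List.Membership.Propositional using (lose) renaming (_∈_ to _∈ₗ_)
open import Data.List.Membership.Propositional.Properties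
  using (∈-filter⁺; ∈-filter⁻; ∈-allFin; ∈-cartesianProduct⁻)
open import Data.List.Properties using (length-++; length-map; length-tabulate; filter-≐; filter-some; filter-none)
open import Data.List.Relation.Unary.All using (All; []; _∷_)
import Data.List.Relation.Unary.All as All
open import Data.List.Relation.Unary.Any using (here; there)
open import Data.List.Relation.Unary.Unique.Propositional using (Unique; []; _∷_)
open import Data.List.Relation.Unary.Unique.Propositional.Properties using (allFin⁺; filter⁺; cartesianProduct⁺)
open import Data.Nat using (ℕ; zero; suc; _^_; _*_; _+_; _<_; _≤_; z≤n; s≤s)
open import Data.Nat.Properties hiding (_≟_)
open import Data.Nat.Tactic.RingSolver using (solve-∀)
open import Data.Product using (Σ; ∃-syntax; _×_; _,_; proj₁; proj₂; swap)
open import Data.Sum using (_⊎_; inj₁; inj₂)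
open import Data.Unit using (tt)
open import Data.Vec using ([]; _∷_; here; there)
import Data.Vec as Vec
open import Data.Vec.Properties using (lookup∘tabulate; []=⇒lookup; lookup⇒[]=)
open import Function using (_∘_)
open import Function.Bundles using (Equivalence)
open import Level using (Level; 0ℓ)
open import Relation.Binary.PropositionalEquality
open import Relation.Nullary using (¬_; Dec; yes; no; _⊎-dec_; _×-dec_; _→-dec_)
open import Relation.Nullary.Decidable using (⌊_⌋)
open import Relation.Unary using (Pred; Decidable)
open import Relation.Unary.Properties using (∅?; _∩?_; _∪?_; ∁?)

open import Defs

private
  variable
    a b ℓ ℓ₁ ℓ₂ ℓ₃ : Level

-- Counting by injections

module _ {A : Set a} where

  remove : {x : A} (ys : List A) → x ∈ₗ ys → List A
  remove (_ ∷ ys) (here _)  = ys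
  remove (y ∷ ys) (there p) = y ∷ remove ys p

  length-remove : {x : A} (ys : List A) (p : x ∈ₗ ys) → suc (length (remove ys p)) ≡ length ys
  length-remove (_ ∷ ys) (here _)  = refl
  length-remove (_ ∷ ys) (there p) = cong suc (length-remove ys p)

  ∈-remove⁺ : {x z : A} (ys : List A) (p : x ∈ₗ ys) → z ∈ₗ ys → z ≢ x → z ∈ₗ remove ys p
  ∈-remove⁺ (_ ∷ ys) (here refl) (here refl) z≢x = ⊥-elim (z≢x refl)
  ∈-remove⁺ (_ ∷ ys) (here refl) (there q)   z≢x = q
  ∈-remove⁺ (_ ∷ ys) (there p)   (here refl) z≢x = here refl
  ∈-remove⁺ (_ ∷ ys) (there p)   (there q)   z≢x = there (∈-remove⁺ ys p q z≢x)

length-≤-of-injection : {A : Set a} {B : Set b} (f : A → B) {xs : List A} {ys : List B} →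
  Unique xs → (∀ {x} → x ∈ₗ xs → f x ∈ₗ ys) →
  (∀ {x y} → x ∈ₗ xs → y ∈ₗ xs → f x ≡ f y → x ≡ y) →
  length xs ≤ length ys
length-≤-of-injection f {[]}     _           _    _   = z≤n
length-≤-of-injection f {x ∷ xs} {ys} (x∉xs ∷ u) into inj =
  subst (suc (length xs) ≤_) (length-remove ys fx∈ys)
    (s≤s (length-≤-of-injection f u into′ (λ p q → inj (there p) (there q))))
  where
  fx∈ys : f x ∈ₗ ys
  fx∈ys = into (here refl)
  into′ : ∀ {z} → z ∈ₗ xs → f z ∈ₗ remove ys fx∈ys
  into′ z∈xs = ∈-remove⁺ ys fx∈ys (into (there z∈xs))
    (λ fz≡fx → All.lookup x∉xs z∈xs (sym (inj (there z∈xs) (here refl) fz≡fx)))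

length-cartesianProduct : {A : Set a} {B : Set b} (xs : List A) (ys : List B) →
  length (cartesianProduct xs ys) ≡ length xs * length ys
length-cartesianProduct []       ys = refl
length-cartesianProduct (x ∷ xs) ys = trans (length-++ (map (x ,_) ys))
  (cong₂ _+_ (length-map (x ,_) ys) (length-cartesianProduct xs ys))

module _ {A : Set a} {P : Pred A ℓ₁} {Q : Pred A ℓ₂} (P? : Decidable P) (Q? : Decidable Q) where

  length-filter-split : (xs : List A) →
    length (filter P? xs) ≡ length (filter (P? ∩? Q?) xs) + length (filter (P? ∩? ∁? Q?) xs)
  length-filter-split []       = refl
  length-filter-split (x ∷ xs) with P? x | Q? x
  ... | yes _ | yes _ = cong suc (length-filter-split xs)
  ... | yes _ | no _  = trans (cong suc (length-filter-split xs)) (sym (+-suc _ _))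
  ... | no _  | _     = length-filter-split xs

length-filter-∁ : {A : Set a} {P : Pred A ℓ} (P? : Decidable P) (xs : List A) →
  length xs ≡ length (filter P? xs) + length (filter (∁? P?) xs)
length-filter-∁ P? []       = refl
length-filter-∁ P? (x ∷ xs) with P? x
... | yes _ = cong suc (length-filter-∁ P? xs)
... | no _  = trans (cong suc (length-filter-∁ P? xs)) (sym (+-suc _ _))

-- Counting decidable subsets of Fin n

module _ {n : ℕ} where

  count : {P : Pred (Fin n) ℓ} → Decidable P → ℕ
  count P? = length (filter P? (allFin n))

  module _ {P : Pred (Fin n) ℓ} (P? : Decidable P) where

    ∈-count⁻ : ∀ {x} → x ∈ₗ filter P? (allFin n) → P x
    ∈-count⁻ x∈ = proj₂ (∈-filter⁻ P? {xs = allFin n} x∈)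

    ∈-count⁺ : ∀ {x} → P x → x ∈ₗ filter P? (allFin n)
    ∈-count⁺ px = ∈-filter⁺ P? (∈-allFin _) px

    count-witness : ∀ {x} → P x → 1 ≤ count P?
    count-witness px = filter-some P? (lose (∈-allFin _) px)

    count-subsingleton : (∀ {x y} → P x → P y → x ≡ y) → count P? ≤ 1
    count-subsingleton P-unique = length-≤-of-injection (λ _ → tt) {ys = tt ∷ []}
      (filter⁺ P? (allFin⁺ n)) (λ _ → here refl) (λ x∈ y∈ _ → P-unique (∈-count⁻ x∈) (∈-count⁻ y∈))

    count-none : (∀ x → ¬ P x) → count P? ≡ 0
    count-none ¬P = cong length (filter-none P? (All.universal ¬P (allFin n)))

    count-unique : {xs : List (Fin n)} → Unique xs → All P xs → length xs ≤ count P?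
    count-unique u all = length-≤-of-injection (λ x → x) u
      (λ x∈xs → ∈-count⁺ (All.lookup all x∈xs)) (λ _ _ eq → eq)

    count-∁ : count P? + count (∁? P?) ≡ n
    count-∁ = trans (sym (length-filter-∁ P? (allFin n))) (length-tabulate (λ x → x))

  module _ {P : Pred (Fin n) ℓ₁} {Q : Pred (Fin n) ℓ₂} (P? : Decidable P) (Q? : Decidable Q) where

    count-cong : (∀ {x} → P x → Q x) → (∀ {x} → Q x → P x) → count P? ≡ count Q?
    count-cong P⇒Q Q⇒P = cong length (filter-≐ P? Q? (P⇒Q , Q⇒P) (allFin n))

    count-split : count P? ≡ count (P? ∩? Q?) + count (P? ∩? ∁? Q?)
    count-split = length-filter-split P? Q? (allFin n)

    count-injective : (f : Fin n → Fin n) → (∀ {x} → P x → Q (f x)) →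
      (∀ {x y} → P x → P y → f x ≡ f y → x ≡ y) → count P? ≤ count Q?
    count-injective f into inj = length-≤-of-injection f (filter⁺ P? (allFin⁺ n))
      (λ x∈ → ∈-count⁺ Q? (into (∈-count⁻ P? x∈)))
      (λ x∈ y∈ → inj (∈-count⁻ P? x∈) (∈-count⁻ P? y∈))

    count-mono : (∀ {x} → P x → Q x) → count P? ≤ count Q?
    count-mono P⇒Q = count-injective (λ x → x) P⇒Q (λ _ _ eq → eq)

  module _ {P : Pred (Fin n) ℓ₁} {Q : Pred (Fin n) ℓ₂} (P? : Decidable P) (Q? : Decidable Q) where

    count-∪ : (∀ {x} → P x → ¬ Q x) → count (P? ∪? Q?) ≡ count P? + count Q?
    count-∪ disjoint = trans (count-split (P? ∪? Q?) P?)
      (cong₂ _+_ (count-cong _ P? proj₂ (λ px → inj₁ px , px))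
                 (count-cong _ Q? onlyQ (λ qx → inj₂ qx , λ px → disjoint px qx)))
      where
      onlyQ : ∀ {x} → (P x ⊎ Q x) × ¬ P x → Q x
      onlyQ (inj₁ px , ¬px) = ⊥-elim (¬px px)
      onlyQ (inj₂ qx , _)   = qx

  count-product : {P : Pred (Fin n) ℓ₁} {Q : Pred (Fin n) ℓ₂} {R : Pred (Fin n) ℓ₃}
    (P? : Decidable P) (Q? : Decidable Q) (R? : Decidable R) (f : Fin n → Fin n → Fin n) →
    (∀ {x y} → P x → Q y → R (f x y)) →
    (∀ {x y x′ y′} → P x → Q y → P x′ → Q y′ → f x y ≡ f x′ y′ → x ≡ x′ × y ≡ y′) →
    count P? * count Q? ≤ count R?
  count-product P? Q? R? f into inj =
    subst (_≤ count R?) (length-cartesianProduct (filter P? (allFin n)) (filter Q? (allFin n)))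
      (length-≤-of-injection (λ (x , y) → f x y)
        (cartesianProduct⁺ (filter⁺ P? (allFin⁺ n)) (filter⁺ Q? (allFin⁺ n)))
        (λ xy∈ → let (x∈ , y∈) = ∈-cartesianProduct⁻ _ _ xy∈ in
                 ∈-count⁺ R? (into (∈-count⁻ P? x∈) (∈-count⁻ Q? y∈)))
        (λ xy∈ xy′∈ eq →
          let (x∈ , y∈) = ∈-cartesianProduct⁻ _ _ xy∈ ; (x′∈ , y′∈) = ∈-cartesianProduct⁻ _ _ xy′∈
              (x≡ , y≡) = inj (∈-count⁻ P? x∈) (∈-count⁻ Q? y∈) (∈-count⁻ P? x′∈) (∈-count⁻ Q? y′∈) eq
          in cong₂ _,_ x≡ y≡))

  module _ {X : Pred (Fin n) ℓ₁} (X? : Decidable X) {Φ : ℕ → Set ℓ₂}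
           (Good : {U : Pred (Fin n) ℓ₃} → Decidable U → Set ℓ₂)
           (sound : ∀ {U} {U? : Decidable U} → Good U? → (∀ {u} → U u → X u) × Φ (count U?))
           (extend : ∀ {U} {U? : Decidable U} → Good U? → ∀ {y} → X y → ¬ U y →
                     Σ (Pred (Fin n) ℓ₃) λ U′ → Σ (Decidable U′) λ U′? → Good U′? × count U? < count U′?)
           where

    exhaustion : ∀ {U} {U? : Decidable U} → Good U? → Φ (count X?)
    exhaustion {U} {U?} good = go (count X?) (m≤n+m (count X?) (count U?)) good
      where
      go : ∀ f {U} {U? : Decidable U} → count X? ≤ count U? + f → Good U? → Φ (count X?)
      go f {U} {U?} bound good with any? (X? ∩? ∁? U?)
      ... | no X⊆U = subst Φ (≤-antisym (count-mono U? X? U⊆X) (count-mono X? U? X⇒U)) ΦU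
        where
        U⊆X : ∀ {u} → U u → X u
        U⊆X = proj₁ (sound good)
        ΦU : Φ (count U?)
        ΦU = proj₂ (sound good)
        X⇒U : ∀ {x} → X x → U x
        X⇒U {x} Xx with U? x
        ... | yes Ux = Ux
        ... | no ¬Ux = ⊥-elim (X⊆U (x , Xx , ¬Ux))
      ... | yes (y , Xy , ¬Uy) with extend good Xy ¬Uy | f
      ...   | _ , U′? , good′ , U<U′ | zero  = ⊥-elim (<-irrefl refl (≤-trans U<U′
               (≤-trans (count-mono U′? X? (proj₁ (sound good′))) (subst (count X? ≤_) (+-identityʳ _) bound))))
      ...   | _ , U′? , good′ , U<U′ | suc f′ = go f′ {U? = U′?}
               (≤-trans bound (subst (_≤ count U′? + f′) (sym (+-suc (count U?) f′)) (+-monoˡ-≤ f′ U<U′))) good′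

least : {n : ℕ} {P : Pred (Fin n) ℓ} → Decidable P → ∀ {x} → P x →
  ∃[ m ] P m × (∀ {z} → P z → m Fin.≤ z)
least {n = suc n} P? {x} px with P? Fin.zero
... | yes p₀ = Fin.zero , p₀ , λ _ → z≤n
least {n = suc n} P? {Fin.zero}  px | no ¬p₀ = ⊥-elim (¬p₀ px)
least {n = suc n} P? {Fin.suc x} px | no ¬p₀ =
  let (m , pm , m≤) = least (λ z → P? (Fin.suc z)) px in
  Fin.suc m , pm , λ { {Fin.zero} pz → ⊥-elim (¬p₀ pz) ; {Fin.suc z} pz → s≤s (m≤ pz) }

length-≤-2^-of-determined : {n : ℕ} (rs : List (Fin n)) {L : List (Subset n)} → Unique L →
  (∀ {S S′} → S ∈ₗ L → S′ ∈ₗ L → (∀ {r} → r ∈ₗ rs → r ∈ S → r ∈ S′) → S ⊆ S′) →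
  length L ≤ 2 ^ length rs
length-≤-2^-of-determined [] {[]}         _ _ = z≤n
length-≤-2^-of-determined [] {_ ∷ []}     _ _ = s≤s z≤n
length-≤-2^-of-determined [] {_ ∷ _ ∷ _} ((S≢ ∷ _) ∷ _) det = ⊥-elim (S≢
  (⊆-antisym (det (here refl) (there (here refl)) (λ ())) (det (there (here refl)) (here refl) (λ ()))))
length-≤-2^-of-determined (r ∷ rs) {L} u det = begin
  length L                                   ≡⟨ length-filter-∁ (r ∈?_) L ⟩
  length (filter (r ∈?_) L) + length (filter (∁? (r ∈?_)) L)
    ≤⟨ +-mono-≤ (length-≤-2^-of-determined rs (filter⁺ (r ∈?_) u) (det′ (r ∈?_) λ _ r∈S′ _ → r∈S′))
                (length-≤-2^-of-determined rs (filter⁺ (∁? (r ∈?_)) u)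
                  (det′ (∁? (r ∈?_)) λ r∉S _ r∈S → ⊥-elim (r∉S r∈S))) ⟩
  2 ^ length rs + 2 ^ length rs              ≡⟨ cong (2 ^ length rs +_) (sym (+-identityʳ _)) ⟩
  2 ^ suc (length rs)                        ∎
  where
  open ≤-Reasoning
  det′ : {Q : Pred (Subset _) ℓ} (Q? : Decidable Q) → (∀ {S S′} → Q S → Q S′ → r ∈ S → r ∈ S′) →
    ∀ {S S′} → S ∈ₗ filter Q? L → S′ ∈ₗ filter Q? L →
    (∀ {z} → z ∈ₗ rs → z ∈ S → z ∈ S′) → S ⊆ S′
  det′ Q? at-r S∈ S′∈ agree =
    let (S∈L , qS) = ∈-filter⁻ Q? S∈ ; (S′∈L , qS′) = ∈-filter⁻ Q? S′∈ in
    det S∈L S′∈L λ { (here refl) → at-r qS qS′ ; (there z∈) → agree z∈ }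

length-filter-tabulate : {A : Set a} {P : Pred A ℓ} (P? : Decidable P) {n : ℕ} (g : Fin n → A) →
  length (filter P? (tabulate g)) ≡ count (λ x → P? (g x))
length-filter-tabulate P? {zero}  g = refl
length-filter-tabulate P? {suc n} g
  with P? (g Fin.zero)
     | length-filter-tabulate P? (λ x → g (Fin.suc x))
     | length-filter-tabulate (λ x → P? (g x)) Fin.suc
... | yes _ | ih | ih′ = cong suc (trans ih (sym ih′))
... | no _  | ih | ih′ = trans ih (sym ih′)

count-∈-tail : {n : ℕ} (s : Side) (S : Subset n) →
  length (filter (_∈? (s ∷ S)) (tabulate Fin.suc)) ≡ count (_∈? S)
count-∈-tail s S = trans (length-filter-tabulate (_∈? (s ∷ S)) Fin.suc)
  (count-cong _ (_∈? S) drop-there there)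

∣∣≡count : {n : ℕ} (S : Subset n) → ∣ S ∣ ≡ count (_∈? S)
∣∣≡count []           = refl
∣∣≡count (inside ∷ S)  = cong suc (trans (∣∣≡count S) (sym (count-∈-tail inside S)))
∣∣≡count (outside ∷ S) = trans (∣∣≡count S) (sym (count-∈-tail outside S))

∈-tabulate⁻ : {n : ℕ} {f : Fin n → Bool} {x : Fin n} → x ∈ Vec.tabulate f → f x ≡ true
∈-tabulate⁻ {f = f} {x} x∈ = trans (sym (lookup∘tabulate f x)) ([]=⇒lookup x∈)

∈-tabulate⁺ : {n : ℕ} {f : Fin n → Bool} {x : Fin n} → f x ≡ true → x ∈ Vec.tabulate f
∈-tabulate⁺ {f = f} {x} fx = lookup⇒[]= x _ (trans (lookup∘tabulate f x) fx)

-- Cosets and classes in a finite abelian group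

module GroupCounting {n : ℕ} (G : FinAbGroup n) where

  open FinAbGroup G

  abelianGroup : AbelianGroup 0ℓ 0ℓ
  abelianGroup = record { isAbelianGroup = isAbelianGroup }

  open AbelianGroupProperties abelianGroup public
  open IsAbelianGroup isAbelianGroup public using (assoc; comm; identityˡ; identityʳ; inverseˡ; inverseʳ)
  open CommutativeSemigroupProperties (AbelianGroup.commutativeSemigroup abelianGroup) public using (interchange; x∙yz≈y∙xz)

  ∙-cancel-middle : ∀ a y z → (a ∙ y) ∙ (y ⁻¹ ∙ z) ≡ a ∙ z
  ∙-cancel-middle a y z = trans (assoc a y (y ⁻¹ ∙ z)) (cong (a ∙_) (\\-leftDividesˡ y z))

  Predicate : Set₁
  Predicate = Pred (Fin n) 0ℓ

  record IsSubgroupPred (V : Predicate) : Set where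
    field
      ε-closed  : V ε
      ∙-closed  : ∀ {x y} → V x → V y → V (x ∙ y)
      ⁻¹-closed : ∀ {x} → V x → V (x ⁻¹)

    ⁻¹-closed⁻ : ∀ {x} → V (x ⁻¹) → V x
    ⁻¹-closed⁻ {x} v = subst V (⁻¹-involutive x) (⁻¹-closed v)

    ∉-∙ : ∀ {x y} → ¬ V x → V y → ¬ V (x ∙ y)
    ∉-∙ {x} {y} ¬Vx Vy Vxy = ¬Vx (subst V (//-rightDividesʳ y x) (∙-closed Vxy (⁻¹-closed Vy)))

    ∉-⁻¹ : ∀ {x} → ¬ V x → ¬ V (x ⁻¹)
    ∉-⁻¹ ¬Vx Vx⁻¹ = ¬Vx (⁻¹-closed⁻ Vx⁻¹)

  isSubgroupPred : {S : Subset n} → IsSubgroup G S → IsSubgroupPred (_∈ S)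
  isSubgroupPred (ε∈S , ∙∈S , ⁻¹∈S) = record
    { ε-closed = ε∈S ; ∙-closed = ∙∈S _ _ ; ⁻¹-closed = ⁻¹∈S _ }

  module _ {P Q : Predicate} (P? : Decidable P) (Q? : Decidable Q) where

    count-translate : (g : Fin n) → (∀ {x} → P x → Q (g ∙ x)) → count P? ≤ count Q?
    count-translate g into = count-injective P? Q? (g ∙_) into (λ _ _ → ∙-cancelˡ g _ _)

    count-invert : (∀ {x} → P x → Q (x ⁻¹)) → count P? ≤ count Q?
    count-invert into = count-injective P? Q? _⁻¹ into (λ _ _ → ⁻¹-injective)

  count-∘⁻¹ : {P : Predicate} (P? : Decidable P) → count (λ x → P? (x ⁻¹)) ≡ count P?
  count-∘⁻¹ {P} P? = ≤-antisym (count-invert _ P? (λ p → p))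
    (count-invert P? _ (λ {x} p → subst P (sym (⁻¹-involutive x)) p))

  count-proper-subgroup : {K : Predicate} (K? : Decidable K) → IsSubgroupPred K →
    ∀ {y} → ¬ K y → 2 * count K? ≤ n
  count-proper-subgroup K? K-sub {y} ¬Ky = begin
    2 * count K?                ≡⟨ cong (count K? +_) (+-identityʳ _) ⟩
    count K? + count K?         ≤⟨ +-monoʳ-≤ (count K?) (count-translate K? (∁? K?) y (λ Kx → ∉-∙ ¬Ky Kx)) ⟩
    count K? + count (∁? K?)    ≡⟨ count-∁ K? ⟩
    n                           ∎
    where
    open ≤-Reasoning
    open IsSubgroupPred K-sub

  module Cosets {V : Predicate} (V? : Decidable V) (V-sub : IsSubgroupPred V) where

    open IsSubgroupPred V-sub

    coset : Fin n → Predicate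
    coset y z = V (y ⁻¹ ∙ z)

    coset? : (y : Fin n) → Decidable (coset y)
    coset? y z = V? (y ⁻¹ ∙ z)

    count-coset : (y : Fin n) → count (coset? y) ≡ count V?
    count-coset y = ≤-antisym
      (count-translate (coset? y) V? (y ⁻¹) (λ v → v))
      (count-translate V? (coset? y) y (λ {x} v → subst V (sym (\\-leftDividesʳ y x)) v))

    coset-closed : ∀ {y z v} → coset y z → V v → coset y (z ∙ v)
    coset-closed {y} {z} {v} c vv = subst V (assoc (y ⁻¹) z v) (∙-closed c vv)

    ∪-coset-subgroup : ∀ {y} → V (y ∙ y) → IsSubgroupPred (λ z → V z ⊎ coset y z)
    ∪-coset-subgroup {y} Vyy = record
      { ε-closed  = inj₁ ε-closed
      ; ∙-closed  = closed
      ; ⁻¹-closed = λ { (inj₁ Vx) → inj₁ (⁻¹-closed Vx) ; (inj₂ c) → inj₂ (inverse c) }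
      }
      where
      y⁻¹x∙y : ∀ x → (y ⁻¹ ∙ x) ∙ y ≡ x
      y⁻¹x∙y x = trans (comm (y ⁻¹ ∙ x) y) (\\-leftDividesˡ y x)
      closed : ∀ {x z} → V x ⊎ coset y x → V z ⊎ coset y z → V (x ∙ z) ⊎ coset y (x ∙ z)
      closed (inj₁ Vx) (inj₁ Vz) = inj₁ (∙-closed Vx Vz)
      closed {x} {z} (inj₁ Vx) (inj₂ c) = inj₂ (subst V (x∙yz≈y∙xz x (y ⁻¹) z) (∙-closed Vx c))
      closed (inj₂ c) (inj₁ Vz) = inj₂ (coset-closed c Vz)
      closed {x} {z} (inj₂ c) (inj₂ c′) = inj₁ (subst V
        (trans (interchange (y ⁻¹ ∙ x) (y ⁻¹ ∙ z) y y) (cong₂ _∙_ (y⁻¹x∙y x) (y⁻¹x∙y z)))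
        (∙-closed (∙-closed c c′) Vyy))
      inverse : ∀ {x} → coset y x → coset y (x ⁻¹)
      inverse {x} c = subst V (trans (sym (⁻¹-∙-comm x y)) (comm (x ⁻¹) (y ⁻¹)))
        (⁻¹-closed (subst V (trans (sym (assoc (y ⁻¹ ∙ x) y y)) (cong (_∙ y) (y⁻¹x∙y x))) (∙-closed c Vyy)))

    count-∪-coset : {U : Predicate} (U? : Decidable U) → (∀ {u v} → U u → V v → U (u ∙ v)) →
      ∀ {y} → ¬ U y → count (U? ∪? coset? y) ≡ count U? + count V?
    count-∪-coset {U} U? U·V⊆U {y} ¬Uy =
      trans (count-∪ U? (coset? y) disjoint) (cong (count U? +_) (count-coset y))
      where
      disjoint : ∀ {z} → U z → ¬ coset y z
      disjoint {z} uz c = ¬Uy (subst U (\\-leftDividesˡ z y)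
        (U·V⊆U uz (subst V (⁻¹-anti-homo-\\ y z) (⁻¹-closed c))))

    count-<-∪-coset : {U : Predicate} (U? : Decidable U) → (∀ {u v} → U u → V v → U (u ∙ v)) →
      ∀ {y} → ¬ U y → count U? < count (U? ∪? coset? y)
    count-<-∪-coset U? U·V⊆U ¬Uy = subst (count U? <_) (sym (count-∪-coset U? U·V⊆U ¬Uy))
      (m<m+n (count U?) (count-witness V? ε-closed))

    lagrange : {X : Predicate} (X? : Decidable X) → (∀ {x v} → X x → V v → X (x ∙ v)) →
      ∃[ t ] count X? ≡ t * count V?
    lagrange {X} X? X·V⊆X = exhaustion X? {Φ = λ c → ∃[ t ] c ≡ t * count V?} Good
      (λ (U⊆X , _ , tU) → U⊆X , tU) extend
      {U? = ∅? {A = Fin n}} ((λ ()) , (λ ()) , 0 , count-none (∅? {A = Fin n}) (λ _ ()))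
      where
      Good : {U : Predicate} → Decidable U → Set
      Good {U} U? = (∀ {u} → U u → X u) × (∀ {u v} → U u → V v → U (u ∙ v)) × ∃[ t ] count U? ≡ t * count V?
      extend : {U : Predicate} {U? : Decidable U} → Good U? → ∀ {y} → X y → ¬ U y →
        Σ Predicate λ U′ → Σ (Decidable U′) λ U′? → Good U′? × count U? < count U′?
      extend {U} {U?} (U⊆X , U·V⊆U , t , cU) {y} Xy ¬Uy =
        _ , U′? , (U′⊆X , U′·V⊆U′ , suc t , cU′) , count-<-∪-coset U? U·V⊆U ¬Uy
        where
        U′? : Decidable (λ u → U u ⊎ coset y u)
        U′? = U? ∪? coset? y
        cU′ : count U′? ≡ suc t * count V?
        cU′ = trans (count-∪-coset U? U·V⊆U ¬Uy) (trans (cong (_+ count V?) cU) (+-comm (t * count V?) (count V?)))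
        U′⊆X : ∀ {u} → U u ⊎ coset y u → X u
        U′⊆X (inj₁ Uu) = U⊆X Uu
        U′⊆X {u} (inj₂ c) = subst X (\\-leftDividesˡ y u) (X·V⊆X Xy c)
        U′·V⊆U′ : ∀ {u v} → U u ⊎ coset y u → V v → U (u ∙ v) ⊎ coset y (u ∙ v)
        U′·V⊆U′ (inj₁ Uu) Vv = inj₁ (U·V⊆U Uu Vv)
        U′·V⊆U′ (inj₂ c)  Vv = inj₂ (coset-closed c Vv)

  trivial-subgroup : IsSubgroupPred (_≡ ε)
  trivial-subgroup = record
    { ε-closed = refl ; ∙-closed = λ { refl refl → identityˡ ε } ; ⁻¹-closed = λ { refl → ε⁻¹≈ε } }

  count-trivial : count (_≟ ε) ≡ 1
  count-trivial = ≤-antisym (count-subsingleton (_≟ ε) (λ x≡ε y≡ε → trans x≡ε (sym y≡ε)))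
                            (count-witness (_≟ ε) refl)

  elementary-abelian : {V : Predicate} (V? : Decidable V) → IsSubgroupPred V →
    (∀ {v} → V v → v ∙ v ≡ ε) → ∃[ j ] count V? ≡ 2 ^ j
  elementary-abelian {V} V? V-sub sq = exhaustion V? {Φ = λ c → ∃[ j ] c ≡ 2 ^ j} Good
    (λ (_ , W⊆V , jW) → W⊆V , jW) extend
    (trivial-subgroup , (λ { refl → ε-closed }) , 0 , count-trivial)
    where
    open IsSubgroupPred V-sub
    Good : {W : Predicate} → Decidable W → Set
    Good {W} W? = IsSubgroupPred W × (∀ {w} → W w → V w) × ∃[ j ] count W? ≡ 2 ^ j
    extend : {W : Predicate} {W? : Decidable W} → Good W? → ∀ {y} → V y → ¬ W y →
      Σ Predicate λ W′ → Σ (Decidable W′) λ W′? → Good W′? × count W? < count W′?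
    extend {W} {W?} (W-sub , W⊆V , j , cW) {y} Vy ¬Wy =
      _ , W′? , (∪-coset-subgroup (subst W (sym (sq Vy)) W.ε-closed) , W′⊆V , suc j , cW′)
        , count-<-∪-coset W? W.∙-closed ¬Wy
      where
      module W = IsSubgroupPred W-sub
      open Cosets W? W-sub
      W′? : Decidable (λ z → W z ⊎ coset y z)
      W′? = W? ∪? coset? y
      cW′ : count W′? ≡ 2 ^ suc j
      cW′ = trans (count-∪-coset W? W.∙-closed ¬Wy)
                  (trans (cong₂ _+_ cW cW) (cong (2 ^ j +_) (sym (+-identityʳ _))))
      W′⊆V : ∀ {z} → W z ⊎ coset y z → V z
      W′⊆V (inj₁ Wz) = W⊆V Wz
      W′⊆V {z} (inj₂ c) = subst V (\\-leftDividesˡ y z) (∙-closed Vy (W⊆V c))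

  Sq : Predicate
  Sq x = x ∙ x ≡ ε

  sq? : Decidable Sq
  sq? x = x ∙ x ≟ ε

  ∣A₂∖∣≡count : (B : Subset n) → ∣ A₂∖ G B ∣ ≡ count (sq? ∩? ∁? (_∈? B))
  ∣A₂∖∣≡count B = trans (∣∣≡count (A₂∖ G B))
    (count-cong (_∈? A₂∖ G B) (sq? ∩? ∁? (_∈? B)) (λ x∈ → to (∈-tabulate⁻ x∈)) (λ p → ∈-tabulate⁺ (from p)))
    where
    to : ∀ {x} → ⌊ x ∙ x ≟ ε ⌋ ∧ not (Vec.lookup B x) ≡ true → Sq x × x ∉ B
    to {x} eq with x ∙ x ≟ ε | Vec.lookup B x in B[x]
    ... | yes xx≡ε | false = xx≡ε , λ x∈B → true≢false (trans (sym ([]=⇒lookup x∈B)) B[x])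
      where
      true≢false : true ≢ false
      true≢false ()
    from : ∀ {x} → Sq x × x ∉ B → ⌊ x ∙ x ≟ ε ⌋ ∧ not (Vec.lookup B x) ≡ true
    from {x} (xx≡ε , x∉B) with x ∙ x ≟ ε | Vec.lookup B x in B[x]
    ... | yes _ | false = refl
    ... | yes _ | true  = ⊥-elim (x∉B (lookup⇒[]= x B B[x]))
    ... | no xx≢ε | _   = ⊥-elim (xx≢ε xx≡ε)

  module IndexTwo {B : Predicate} (B? : Decidable B) (B-sub : IsSubgroupPred B) (index : 2 * count B? ≡ n) where

    open IsSubgroupPred B-sub

    count-outside : count (∁? B?) ≡ count B?
    count-outside = +-cancelˡ-≡ (count B?) _ _
      (trans (count-∁ B?) (trans (sym index) (cong (count B? +_) (+-identityʳ _))))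

    outside-∙-outside : ∀ {x y} → ¬ B x → ¬ B y → B (x ∙ y)
    outside-∙-outside {x} {y} ¬Bx ¬By with B? (x ∙ y)
    ... | yes Bxy = Bxy
    ... | no ¬Bxy = ⊥-elim (<-irrefl refl (begin-strict
      count B?                          <⟨ m<m+n (count B?) (count-witness (_≟ y) refl) ⟩
      count B? + count (_≟ y)           ≡⟨ count-∪ B? (_≟ y) (λ { Bz refl → ¬By Bz }) ⟨
      count (B? ∪? (_≟ y))
        ≤⟨ count-translate _ (∁? B?) x (λ { (inj₁ Bz) → ∉-∙ ¬Bx Bz ; (inj₂ refl) → ¬Bxy }) ⟩
      count (∁? B?)                     ≡⟨ count-outside ⟩
      count B?                          ∎))
      where open ≤-Reasoning

    count-outside-≤-half : {K : Predicate} (K? : Decidable K) → IsSubgroupPred K →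
      2 * count (K? ∩? ∁? B?) ≤ count K?
    count-outside-≤-half K? K-sub with any? (K? ∩? ∁? B?)
    ... | no ¬∃ = subst (λ c → 2 * c ≤ count K?) (sym (count-none _ λ x KBx → ¬∃ (x , KBx))) z≤n
    ... | yes (g , Kg , ¬Bg) = begin
      2 * count (K? ∩? ∁? B?)                        ≡⟨ cong (count (K? ∩? ∁? B?) +_) (+-identityʳ _) ⟩
      count (K? ∩? ∁? B?) + count (K? ∩? ∁? B?)
        ≤⟨ +-monoˡ-≤ _ (count-translate _ (K? ∩? B?) g
             (λ (Kx , ¬Bx) → IsSubgroupPred.∙-closed K-sub Kg Kx , outside-∙-outside ¬Bg ¬Bx)) ⟩
      count (K? ∩? B?) + count (K? ∩? ∁? B?)         ≡⟨ count-split K? B? ⟨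
      count K?                                       ∎
      where open ≤-Reasoning

    involutions-subgroup : IsSubgroupPred (λ x → B x × Sq x)
    involutions-subgroup = record
      { ε-closed  = ε-closed , identityˡ ε
      ; ∙-closed  = λ { {x} {y} (Bx , xx≡ε) (By , yy≡ε) → ∙-closed Bx By ,
          trans (interchange x y x y) (trans (cong₂ _∙_ xx≡ε yy≡ε) (identityˡ ε)) }
      ; ⁻¹-closed = λ { {x} (Bx , xx≡ε) → ⁻¹-closed Bx ,
          trans (⁻¹-∙-comm x x) (trans (cong _⁻¹ xx≡ε) ε⁻¹≈ε) }
      }

    3*-count-involutions-≤ : ¬ (∃[ k ] n ≡ 2 ^ k) → 3 * count (B? ∩? sq?) ≤ count B?
    3*-count-involutions-≤ ¬2^k with Cosets.lagrange (B? ∩? sq?) involutions-subgroup B? (λ Bx (Bv , _) → ∙-closed Bx Bv)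
                                  | elementary-abelian (B? ∩? sq?) involutions-subgroup proj₂
    ... | zero , cB | _ = ⊥-elim (<-irrefl (sym cB) (count-witness B? ε-closed))
    ... | 1 , cB | j , cV = ⊥-elim (¬2^k (suc j , trans (sym index) (cong (2 *_) (trans cB (trans (*-identityˡ _) cV)))))
    ... | 2 , cB | j , cV = ⊥-elim (¬2^k (2 + j , trans (sym index) (cong (2 *_) (trans cB (cong (2 *_) cV)))))
    ... | suc (suc (suc t)) , cB | _ = subst (3 * count (B? ∩? sq?) ≤_) (sym cB)
      (*-monoˡ-≤ (count (B? ∩? sq?)) {3} {3 + t} (s≤s (s≤s (s≤s z≤n))))

  module Transversal {H : Predicate} (H? : Decidable H) (H-sub : IsSubgroupPred H) where

    open IsSubgroupPred H-sub

    -- z ∈ xH ∪ x⁻¹H: an equivalence relation whose classes are the least Saturated sets.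
    Linked : Fin n → Fin n → Set
    Linked x z = H (x ⁻¹ ∙ z) ⊎ H (x ∙ z)

    linked? : ∀ x z → Dec (Linked x z)
    linked? x z = H? (x ⁻¹ ∙ z) ⊎-dec H? (x ∙ z)

    linked-refl : ∀ {x} → Linked x x
    linked-refl {x} = inj₁ (subst H (sym (inverseˡ x)) ε-closed)

    linked-sym : ∀ {x z} → Linked x z → Linked z x
    linked-sym {x} {z} (inj₁ h) = inj₁ (subst H (⁻¹-anti-homo-\\ x z) (⁻¹-closed h))
    linked-sym {x} {z} (inj₂ h) = inj₂ (subst H (comm x z) h)

    linked-trans : ∀ {x y z} → Linked x y → Linked y z → Linked x z
    linked-trans {x} {y} {z} (inj₁ h) (inj₁ h′) = inj₁ (subst H (∙-cancel-middle (x ⁻¹) y z) (∙-closed h h′))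
    linked-trans {x} {y} {z} (inj₂ h) (inj₁ h′) = inj₂ (subst H (∙-cancel-middle x y z) (∙-closed h h′))
    linked-trans {x} {y} {z} (inj₁ h) (inj₂ h′) = inj₂ (subst H (trans (∙-cancel-middle z y x) (comm z x))
      (∙-closed (subst H (comm y z) h′) (subst H (⁻¹-anti-homo-\\ x y) (⁻¹-closed h))))
    linked-trans {x} {y} {z} (inj₂ h) (inj₂ h′) = inj₁ (subst H eq (∙-closed (⁻¹-closed h) h′))
      where
      eq : (x ∙ y) ⁻¹ ∙ (y ∙ z) ≡ x ⁻¹ ∙ z
      eq = trans (cong (_∙ (y ∙ z)) (sym (⁻¹-∙-comm x y)))
        (trans (assoc (x ⁻¹) (y ⁻¹) (y ∙ z)) (cong (x ⁻¹ ∙_) (\\-leftDividesʳ y z)))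

    Saturated : Predicate → Set
    Saturated P = (∀ {x h} → P x → H h → P (x ∙ h)) × (∀ {x} → P x → P (x ⁻¹))

    saturated-linked : {P : Predicate} → Saturated P → ∀ {x z} → P x → Linked x z → P z
    saturated-linked {P} (·H , _)   {x} {z} Px (inj₁ h) = subst P (\\-leftDividesˡ x z) (·H Px h)
    saturated-linked {P} (·H , inv) {x} {z} Px (inj₂ h) = subst P (\\-leftDividesʳ x z) (·H (inv Px) h)

    count-cosets : {P Q : Predicate} (P? : Decidable P) (Q? : Decidable Q) →
      (∀ {x x′} → P x → P x′ → H (x ⁻¹ ∙ x′) → x ≡ x′) → (∀ {x h} → P x → H h → Q (x ∙ h)) →
      count P? * count H? ≤ count Q?
    count-cosets {P} P? Q? separated into = count-product P? H? Q? _∙_ into injective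
      where
      injective : ∀ {x h x′ h′} → P x → H h → P x′ → H h′ → x ∙ h ≡ x′ ∙ h′ → x ≡ x′ × h ≡ h′
      injective {x} {h} {x′} {h′} Px Hh Px′ Hh′ eq = x≡x′ , ∙-cancelˡ x h h′ (trans eq (cong (_∙ h′) (sym x≡x′)))
        where
        open ≡-Reasoning
        shift : h ∙ h′ ⁻¹ ≡ x ⁻¹ ∙ x′
        shift = begin
          h ∙ h′ ⁻¹                   ≡⟨ \\-leftDividesʳ x _ ⟨
          x ⁻¹ ∙ (x ∙ (h ∙ h′ ⁻¹))    ≡⟨ cong (x ⁻¹ ∙_) (assoc x h (h′ ⁻¹)) ⟨
          x ⁻¹ ∙ ((x ∙ h) ∙ h′ ⁻¹)    ≡⟨ cong (λ t → x ⁻¹ ∙ (t ∙ h′ ⁻¹)) eq ⟩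
          x ⁻¹ ∙ ((x′ ∙ h′) ∙ h′ ⁻¹)  ≡⟨ cong (x ⁻¹ ∙_) (//-rightDividesʳ h′ x′) ⟩
          x ⁻¹ ∙ x′                   ∎
        x≡x′ : x ≡ x′
        x≡x′ = separated Px Px′ (subst H shift (∙-closed Hh (⁻¹-closed Hh′)))

    module Representatives {X : Predicate} (X? : Decidable X) (X-sat : Saturated X) where

      Rep : Predicate
      Rep r = X r × (∀ z → Linked r z → r Fin.≤ z)

      rep? : Decidable Rep
      rep? r = X? r ×-dec all? (λ z → linked? r z →-dec (r Fin.≤? z))

      rep-unique : ∀ {r r′} → Rep r → Rep r′ → Linked r r′ → r ≡ r′
      rep-unique (_ , r-min) (_ , r′-min) l = Finₚ.≤-antisym (r-min _ l) (r′-min _ (linked-sym l))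

      rep-separated : ∀ {r r′} → Rep r → Rep r′ → H (r ⁻¹ ∙ r′) → r ≡ r′
      rep-separated Rr Rr′ h = rep-unique Rr Rr′ (inj₁ h)

      rep-exists : ∀ {x} → X x → ∃[ r ] Rep r × Linked x r
      rep-exists {x} Xx =
        let (r , l , r-min) = least (linked? x) linked-refl in
        r , (saturated-linked X-sat Xx l , λ z l′ → r-min (linked-trans l l′)) , l

      SelfPaired : Predicate
      SelfPaired r = H (r ∙ r)

      selfPaired? : Decidable SelfPaired
      selfPaired? r = H? (r ∙ r)

      -- T is a transversal of the H-cosets covering X: each representative r, and also r⁻¹
      -- when r⁻¹H ≠ rH.
      count-reps-*-≤ : (count rep? + count (rep? ∩? ∁? selfPaired?)) * count H? ≤ count X?
      count-reps-*-≤ = subst (λ c → c * count H? ≤ count X?) count-T (count-cosets T? X? separated into)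
        where
        T : Predicate
        T x = Rep x ⊎ (Rep (x ⁻¹) × ¬ SelfPaired (x ⁻¹))
        T? : Decidable T
        T? = rep? ∪? (λ x → (rep? ∩? ∁? selfPaired?) (x ⁻¹))
        x∙x′⁻¹ : ∀ {x x′} → H (x ⁻¹ ∙ x′) → H (x ∙ x′ ⁻¹)
        x∙x′⁻¹ {x} {x′} h = subst H (trans (⁻¹-anti-homo-\\ x x′) (comm (x′ ⁻¹) x)) (⁻¹-closed h)
        disjoint : ∀ {x} → Rep x → ¬ (Rep (x ⁻¹) × ¬ SelfPaired (x ⁻¹))
        disjoint {x} Rx (Rx⁻¹ , ¬sp) = ¬sp (subst (λ t → H (x ⁻¹ ∙ t)) x≡x⁻¹ (subst H (sym (inverseˡ x)) ε-closed))
          where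
          x≡x⁻¹ : x ≡ x ⁻¹
          x≡x⁻¹ = rep-unique Rx Rx⁻¹ (inj₂ (subst H (sym (inverseʳ x)) ε-closed))
        count-T : count T? ≡ count rep? + count (rep? ∩? ∁? selfPaired?)
        count-T = trans (count-∪ rep? _ disjoint) (cong (count rep? +_) (count-∘⁻¹ (rep? ∩? ∁? selfPaired?)))
        separated : ∀ {x x′} → T x → T x′ → H (x ⁻¹ ∙ x′) → x ≡ x′
        separated (inj₁ Rx) (inj₁ Rx′) h = rep-separated Rx Rx′ h
        separated {x} {x′} (inj₁ Rx) (inj₂ (Rr , ¬sp)) h =
          ⊥-elim (¬sp (subst (λ t → H (t ∙ x′ ⁻¹)) (rep-unique Rx Rr (inj₂ (x∙x′⁻¹ h))) (x∙x′⁻¹ h)))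
        separated {x} {x′} (inj₂ (Rr , ¬sp)) (inj₁ Rx′) h =
          ⊥-elim (¬sp (subst (λ t → H (x ⁻¹ ∙ t)) (sym (rep-unique Rr Rx′ (inj₂ h))) h))
        separated {x} {x′} (inj₂ (Rr , _)) (inj₂ (Rr′ , _)) h = ⁻¹-injective
          (rep-unique Rr Rr′ (inj₁ (subst (λ t → H (t ∙ x′ ⁻¹)) (sym (⁻¹-involutive x)) (x∙x′⁻¹ h))))
        into : ∀ {x h} → T x → H h → X (x ∙ h)
        into (inj₁ (Xx , _)) Hh = proj₁ X-sat Xx Hh
        into {x} (inj₂ ((Xx⁻¹ , _) , _)) Hh =
          proj₁ X-sat (subst X (⁻¹-involutive x) (proj₂ X-sat Xx⁻¹)) Hh

      agree-on-reps : {S S′ : Predicate} → Saturated (λ x → X x × S x) → Saturated (λ x → X x × S′ x) →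
        (∀ {r} → Rep r → S r → S′ r) → ∀ {x} → X x → S x → S′ x
      agree-on-reps S-sat S′-sat agree {x} Xx Sx =
        let (r , Rr@(Xr , _) , l) = rep-exists Xx
            Sr = proj₂ (saturated-linked S-sat (Xx , Sx) l)
        in proj₂ (saturated-linked S′-sat (Xr , agree Rr Sr) (linked-sym l))

  module InversePairs {X : Predicate} (X? : Decidable X) (X-inv : ∀ {x} → X x → X (x ⁻¹)) where

    open Transversal (_≟ ε) trivial-subgroup public

    inverse-closed-saturated : {P : Predicate} → (∀ {x} → P x → P (x ⁻¹)) → Saturated P
    inverse-closed-saturated {P} P-inv = (λ { {x} Px refl → subst P (sym (identityʳ x)) Px }) , P-inv

    X-saturated : Saturated X
    X-saturated = inverse-closed-saturated X-inv

    open Representatives X? X-saturated public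

    count-reps-≤ : 2 * count rep? ≤ count X? + count (X? ∩? sq?)
    count-reps-≤ = begin
      2 * r                 ≡⟨ cong (r +_) (+-identityʳ r) ⟩
      r + r                 ≡⟨ cong (_+ r) (count-split rep? sq?) ⟩
      p + q + r             ≡⟨ trans (+-assoc p q r) (cong (p +_) (+-comm q r)) ⟩
      p + (r + q)           ≤⟨ +-mono-≤ (count-mono _ (X? ∩? sq?) (λ ((Xx , _) , xx≡ε) → Xx , xx≡ε)) reps-bound ⟩
      count (X? ∩? sq?) + count X?   ≡⟨ +-comm (count (X? ∩? sq?)) (count X?) ⟩
      count X? + count (X? ∩? sq?)   ∎
      where
      open ≤-Reasoning
      r p q : ℕ
      r = count rep?
      p = count (rep? ∩? sq?)
      q = count (rep? ∩? ∁? sq?)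
      reps-bound : r + q ≤ count X?
      reps-bound = subst (_≤ count X?) (trans (cong ((r + q) *_) count-trivial) (*-identityʳ (r + q))) count-reps-*-≤

  module OrderTwo {H : Predicate} (H? : Decidable H) (H-sub : IsSubgroupPred H) (order : count H? ≡ 2) where

    open IsSubgroupPred H-sub

    nontrivial-unique : ∀ {h h′} → H h → H h′ → h ≢ ε → h′ ≢ ε → h ≡ h′
    nontrivial-unique {h} {h′} Hh Hh′ h≢ε h′≢ε with h ≟ h′
    ... | yes h≡h′ = h≡h′
    ... | no h≢h′ = ⊥-elim (3≰2 (subst (3 ≤_) order
      (count-unique H? (((h≢ε ∘ sym) ∷ (h′≢ε ∘ sym) ∷ []) ∷ (h≢h′ ∷ []) ∷ [] ∷ [])
                       (ε-closed ∷ Hh ∷ Hh′ ∷ []))))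
      where
      3≰2 : ¬ 3 ≤ 2
      3≰2 (s≤s (s≤s ()))

    square-trivial : ∀ {h} → H h → h ∙ h ≡ ε
    square-trivial {h} Hh with h ∙ h ≟ ε
    ... | yes hh≡ε = hh≡ε
    ... | no hh≢ε = ⊥-elim (h≢ε (identityʳ-unique h h (nontrivial-unique (∙-closed Hh Hh) Hh hh≢ε h≢ε)))
      where
      h≢ε : h ≢ ε
      h≢ε h≡ε = hh≢ε (trans (cong₂ _∙_ h≡ε h≡ε) (identityˡ ε))

12*-≤-of-3*-≤ : ∀ c o a b → 3 * c ≤ o → o ≤ b → 12 * c ≤ 3 * o + 3 * a + b
12*-≤-of-3*-≤ c o a b 3c≤o o≤b = begin
  12 * c             ≡⟨ *-assoc 4 3 c ⟩
  4 * (3 * c)        ≤⟨ *-monoʳ-≤ 4 3c≤o ⟩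
  4 * o              ≡⟨ +-comm o (3 * o) ⟩
  3 * o + o          ≤⟨ +-monoʳ-≤ (3 * o) (≤-trans o≤b (m≤n+m b (3 * a))) ⟩
  3 * o + (3 * a + b) ≡⟨ +-assoc (3 * o) (3 * a) b ⟨
  3 * o + 3 * a + b  ∎
  where open ≤-Reasoning

12*-≤-of-split : ∀ c p q r o a v b → c ≡ q + r + p →
  (c + p) * 2 ≤ o → q * 2 ≤ a → r * 2 ≤ v → 3 * v ≤ b → 12 * c ≤ 3 * o + 3 * a + b
12*-≤-of-split c p q r o a v b refl c+p≤ q≤ r≤ 3v≤b = begin
  12 * c                                            ≡⟨ split q r p ⟩
  3 * ((c + p) * 2) + 3 * (q * 2) + 3 * (r * 2)
    ≤⟨ +-mono-≤ (+-mono-≤ (*-monoʳ-≤ 3 c+p≤) (*-monoʳ-≤ 3 q≤)) (*-monoʳ-≤ 3 r≤) ⟩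
  3 * o + 3 * a + 3 * v                             ≤⟨ +-monoʳ-≤ (3 * o + 3 * a) 3v≤b ⟩
  3 * o + 3 * a + b                                 ∎
  where
  open ≤-Reasoning
  split : ∀ q r p → 12 * (q + r + p) ≡ 3 * ((q + r + p + p) * 2) + 3 * (q * 2) + 3 * (r * 2)
  split = solve-∀

48*-≤ : ∀ r₁ r₂ k o a₁ a₂ b → 2 * r₁ ≤ k + a₁ → 12 * r₂ ≤ 3 * o + 3 * a₂ + b →
  4 * k ≤ 2 * b → k + o ≡ b →
  48 * (r₁ + r₂) ≤ 11 * (2 * b) + 24 * (a₁ + a₂)
48*-≤ r₁ r₂ k o a₁ a₂ b r₁≤ r₂≤ 4k≤ refl = begin
  48 * (r₁ + r₂)                                      ≡⟨ e₁ r₁ r₂ ⟩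
  24 * (2 * r₁) + 4 * (12 * r₂)                       ≤⟨ +-mono-≤ (*-monoʳ-≤ 24 r₁≤) (*-monoʳ-≤ 4 r₂≤) ⟩
  24 * (k + a₁) + 4 * (3 * o + 3 * a₂ + b)            ≡⟨ e₂ k o a₁ a₂ ⟩
  16 * (k + o) + 3 * (4 * k) + 24 * a₁ + 12 * a₂
    ≤⟨ +-monoˡ-≤ (12 * a₂) (+-monoˡ-≤ (24 * a₁) (+-monoʳ-≤ (16 * b) (*-monoʳ-≤ 3 4k≤))) ⟩
  16 * b + 3 * (2 * b) + 24 * a₁ + 12 * a₂           ≤⟨ m≤m+n _ (12 * a₂) ⟩
  16 * b + 3 * (2 * b) + 24 * a₁ + 12 * a₂ + 12 * a₂ ≡⟨ e₃ b a₁ a₂ ⟩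
  11 * (2 * b) + 24 * (a₁ + a₂)                       ∎
  where
  open ≤-Reasoning
  e₁ : ∀ r₁ r₂ → 48 * (r₁ + r₂) ≡ 24 * (2 * r₁) + 4 * (12 * r₂)
  e₁ = solve-∀
  e₂ : ∀ k o a₁ a₂ → 24 * (k + a₁) + 4 * (3 * o + 3 * a₂ + (k + o)) ≡ 16 * (k + o) + 3 * (4 * k) + 24 * a₁ + 12 * a₂
  e₂ = solve-∀
  e₃ : ∀ b a₁ a₂ → 16 * b + 3 * (2 * b) + 24 * a₁ + 12 * a₂ + 12 * a₂ ≡ 11 * (2 * b) + 24 * (a₁ + a₂)
  e₃ = solve-∀

module Setting {n : ℕ} (G : FinAbGroup n) (n≢2^k : ¬ (∃[ k ] n ≡ 2 ^ k)) (B H K : Subset n)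
  (B-subgroup : IsSubgroup G B) (index : 2 * ∣ B ∣ ≡ n)
  (H-subgroup : IsSubgroup G H) (K-subgroup : IsSubgroup G K)
  (H-nontrivial : 1 < ∣ H ∣) (H⊆K : H ⊆ K) (K-proper : ∣ K ∣ < n) (H⊆B : H ⊆ B) where

  open FinAbGroup G
  open GroupCounting G

  private
    module B = IsSubgroupPred (isSubgroupPred B-subgroup)
    module H = IsSubgroupPred (isSubgroupPred H-subgroup)
    module K = IsSubgroupPred (isSubgroupPred K-subgroup)

  open IndexTwo (_∈? B) (isSubgroupPred B-subgroup) (trans (cong (2 *_) (sym (∣∣≡count B))) index)

  InK : Predicate
  InK x = x ∈ K × x ∉ B

  inK? : Decidable InK
  inK? = (_∈? K) ∩? ∁? (_∈? B)

  OutK : Predicate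
  OutK x = x ∉ B × x ∉ K

  outK? : Decidable OutK
  outK? = ∁? (_∈? B) ∩? ∁? (_∈? K)

  module Pairs = InversePairs inK? (λ (x∈K , x∉B) → K.⁻¹-closed x∈K , B.∉-⁻¹ x∉B)

  module Classes where
    open Transversal (_∈? H) (isSubgroupPred H-subgroup) public

    outK-saturated : Saturated OutK
    outK-saturated = (λ (x∉B , x∉K) h∈H → B.∉-∙ x∉B (H⊆B h∈H) , K.∉-∙ x∉K (H⊆K h∈H))
                   , (λ (x∉B , x∉K) → B.∉-⁻¹ x∉B , K.∉-⁻¹ x∉K)

    open Representatives outK? outK-saturated public

  count-inK+outK : count inK? + count outK? ≡ count (_∈? B)
  count-inK+outK = begin
    count inK? + count outK?                                     ≡⟨ cong (_+ count outK?) (count-cong inK? _ swap swap) ⟩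
    count (∁? (_∈? B) ∩? (_∈? K)) + count outK?                  ≡⟨ count-split (∁? (_∈? B)) (_∈? K) ⟨
    count (∁? (_∈? B))                                           ≡⟨ count-outside ⟩
    count (_∈? B)                                                ∎
    where open ≡-Reasoning

  count-inK-≤ : 4 * count inK? ≤ 2 * count (_∈? B)
  count-inK-≤ = begin
    4 * count inK?          ≡⟨ *-assoc 2 2 (count inK?) ⟩
    2 * (2 * count inK?)    ≤⟨ *-monoʳ-≤ 2 (count-outside-≤-half (_∈? K) (isSubgroupPred K-subgroup)) ⟩
    2 * count (_∈? K)       ≤⟨ count-proper-subgroup (_∈? K) (isSubgroupPred K-subgroup) (proj₂ y∉K) ⟩
    n                       ≡⟨ trans (sym index) (cong (2 *_) (∣∣≡count B)) ⟩
    2 * count (_∈? B)       ∎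
    where
    open ≤-Reasoning
    y∉K : ∃[ y ] y ∉ K
    y∉K with any? (∁? (_∈? K))
    ... | yes ∃y∉K = ∃y∉K
    ... | no ∄y∉K = ⊥-elim (<-irrefl (begin-equality
      ∣ K ∣                                 ≡⟨ ∣∣≡count K ⟩
      count (_∈? K)                         ≡⟨ +-identityʳ _ ⟨
      count (_∈? K) + 0
        ≡⟨ cong (count (_∈? K) +_) (count-none (∁? (_∈? K)) (λ y y∉K → ∄y∉K (y , y∉K))) ⟨
      count (_∈? K) + count (∁? (_∈? K))    ≡⟨ count-∁ (_∈? K) ⟩
      n                                     ∎) K-proper)

  count-A₂∖B : ∣ A₂∖ G B ∣ ≡ count (inK? ∩? sq?) + count (outK? ∩? sq?)
  count-A₂∖B = begin
    ∣ A₂∖ G B ∣                                                         ≡⟨ ∣A₂∖∣≡count B ⟩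
    count A₂∖B?                                                         ≡⟨ count-split A₂∖B? (_∈? K) ⟩
    count (A₂∖B? ∩? (_∈? K)) + count (A₂∖B? ∩? ∁? (_∈? K))
      ≡⟨ cong₂ _+_
           (count-cong (A₂∖B? ∩? (_∈? K)) (inK? ∩? sq?)
             (λ ((xx , x∉B) , x∈K) → (x∈K , x∉B) , xx) (λ ((x∈K , x∉B) , xx) → (xx , x∉B) , x∈K))
           (count-cong (A₂∖B? ∩? ∁? (_∈? K)) (outK? ∩? sq?)
             (λ ((xx , x∉B) , x∉K) → (x∉B , x∉K) , xx) (λ ((x∉B , x∉K) , xx) → (xx , x∉B) , x∉K)) ⟩
    count (inK? ∩? sq?) + count (outK? ∩? sq?)                          ∎
    where
    open ≡-Reasoning
    A₂∖B? : Decidable (λ x → Sq x × x ∉ B)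
    A₂∖B? = sq? ∩? ∁? (_∈? B)

  count-class-reps-≤-large : 3 ≤ count (_∈? H) →
    12 * count Classes.rep? ≤ 3 * count outK? + 3 * count (outK? ∩? sq?) + count (_∈? B)
  count-class-reps-≤-large 3≤∣H∣ = 12*-≤-of-3*-≤ c (count outK?) (count (outK? ∩? sq?)) (count (_∈? B))
    (begin
      3 * c                  ≡⟨ *-comm 3 c ⟩
      c * 3                  ≤⟨ *-monoʳ-≤ c 3≤∣H∣ ⟩
      c * count (_∈? H)      ≤⟨ *-monoˡ-≤ (count (_∈? H)) (m≤m+n c p) ⟩
      (c + p) * count (_∈? H) ≤⟨ count-reps-*-≤ ⟩
      count outK?            ∎)
    (subst (count outK? ≤_) count-inK+outK (m≤n+m (count outK?) (count inK?)))
    where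
    open ≤-Reasoning
    open Classes
    c p : ℕ
    c = count rep?
    p = count (rep? ∩? ∁? selfPaired?)

  module OrderTwoCase (order : count (_∈? H) ≡ 2) where

    open OrderTwo (_∈? H) (isSubgroupPred H-subgroup) order
    open Classes

    square-∙-H : ∀ {x h} → h ∈ H → (x ∙ h) ∙ (x ∙ h) ≡ x ∙ x
    square-∙-H {x} {h} h∈H = trans (interchange x h x h) (trans (cong (x ∙ x ∙_) (square-trivial h∈H)) (identityʳ _))

    SquareInH : Predicate
    SquareInH z = (z ∉ B × z ∙ z ≢ ε) × z ∙ z ∈ H

    squareInH? : Decidable SquareInH
    squareInH? = (∁? (_∈? B) ∩? ∁? sq?) ∩? (λ z → z ∙ z ∈? H)

    -- Translation works since all elements of SquareInH square to the generator of H.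
    count-squareInH-≤ : count squareInH? ≤ count ((_∈? B) ∩? sq?)
    count-squareInH-≤ with any? squareInH?
    ... | no ∄ = subst (_≤ count ((_∈? B) ∩? sq?)) (sym (count-none squareInH? (λ z p → ∄ (z , p)))) z≤n
    ... | yes (x₀ , (x₀∉B , x₀x₀≢ε) , x₀x₀∈H) = count-translate squareInH? ((_∈? B) ∩? sq?) (x₀ ⁻¹)
      λ {z} ((z∉B , zz≢ε) , zz∈H) → outside-∙-outside (B.∉-⁻¹ x₀∉B) z∉B , (begin
        (x₀ ⁻¹ ∙ z) ∙ (x₀ ⁻¹ ∙ z)     ≡⟨ interchange (x₀ ⁻¹) z (x₀ ⁻¹) z ⟩
        (x₀ ⁻¹ ∙ x₀ ⁻¹) ∙ (z ∙ z)     ≡⟨ cong (_∙ (z ∙ z)) (⁻¹-∙-comm x₀ x₀) ⟩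
        (x₀ ∙ x₀) ⁻¹ ∙ (z ∙ z)
          ≡⟨ cong (λ t → t ⁻¹ ∙ (z ∙ z)) (nontrivial-unique x₀x₀∈H zz∈H x₀x₀≢ε zz≢ε) ⟩
        (z ∙ z) ⁻¹ ∙ (z ∙ z)          ≡⟨ inverseˡ (z ∙ z) ⟩
        ε                             ∎)
      where open ≡-Reasoning

    paired? : Decidable (λ x → Rep x × SelfPaired x)
    paired? = rep? ∩? selfPaired?

    count-paired-sq-≤ : count (paired? ∩? sq?) * 2 ≤ count (outK? ∩? sq?)
    count-paired-sq-≤ = subst (λ m → count (paired? ∩? sq?) * m ≤ count (outK? ∩? sq?)) order
      (count-cosets (paired? ∩? sq?) (outK? ∩? sq?)
        (λ ((Rx , _) , _) ((Rx′ , _) , _) → rep-separated Rx Rx′)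
        (λ (((Ox , _) , _) , xx≡ε) h∈H → proj₁ outK-saturated Ox h∈H , trans (square-∙-H h∈H) xx≡ε))

    count-paired-¬sq-≤ : count (paired? ∩? ∁? sq?) * 2 ≤ count squareInH?
    count-paired-¬sq-≤ = subst (λ m → count (paired? ∩? ∁? sq?) * m ≤ count squareInH?) order
      (count-cosets (paired? ∩? ∁? sq?) squareInH?
        (λ ((Rx , _) , _) ((Rx′ , _) , _) → rep-separated Rx Rx′)
        (λ (((Ox , _) , xx∈H) , xx≢ε) h∈H →
          (proj₁ (proj₁ outK-saturated Ox h∈H) , (λ e → xx≢ε (trans (sym (square-∙-H h∈H)) e))) ,
          subst (_∈ H) (sym (square-∙-H h∈H)) xx∈H))

    count-class-reps-≤-two : 12 * count rep? ≤ 3 * count outK? + 3 * count (outK? ∩? sq?) + count (_∈? B)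
    count-class-reps-≤-two = 12*-≤-of-split c p (count (paired? ∩? sq?)) (count (paired? ∩? ∁? sq?))
      (count outK?) (count (outK? ∩? sq?)) (count ((_∈? B) ∩? sq?)) (count (_∈? B))
      (trans (count-split rep? selfPaired?) (cong (_+ p) (count-split paired? sq?)))
      (subst (λ m → (c + p) * m ≤ count outK?) order count-reps-*-≤)
      count-paired-sq-≤
      (≤-trans count-paired-¬sq-≤ count-squareInH-≤)
      (3*-count-involutions-≤ n≢2^k)
      where
      c p : ℕ
      c = count rep?
      p = count (rep? ∩? ∁? selfPaired?)

  count-class-reps-≤ : 12 * count Classes.rep? ≤ 3 * count outK? + 3 * count (outK? ∩? sq?) + count (_∈? B)
  count-class-reps-≤ with count (_∈? H) in ∣H∣≡ | subst (1 <_) (∣∣≡count H) H-nontrivial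
  ... | 1 | s≤s ()
  ... | 2 | _ = OrderTwoCase.count-class-reps-≤-two ∣H∣≡
  ... | suc (suc (suc m)) | _ = count-class-reps-≤-large (subst (3 ≤_) (sym ∣H∣≡) (s≤s (s≤s (s≤s z≤n))))

  Reps : Predicate
  Reps r = Pairs.Rep r ⊎ Classes.Rep r

  reps? : Decidable Reps
  reps? = Pairs.rep? ∪? Classes.rep?

  count-reps≡ : count reps? ≡ count Pairs.rep? + count Classes.rep?
  count-reps≡ = count-∪ Pairs.rep? Classes.rep? (λ ((r∈K , _) , _) ((_ , r∉K) , _) → r∉K r∈K)

  48*-count-reps-≤ : 48 * count reps? ≤ 11 * n + 24 * ∣ A₂∖ G B ∣
  48*-count-reps-≤ = begin
    48 * count reps?                                  ≡⟨ cong (48 *_) count-reps≡ ⟩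
    48 * (count Pairs.rep? + count Classes.rep?)
      ≤⟨ 48*-≤ (count Pairs.rep?) (count Classes.rep?) (count inK?) (count outK?)
               (count (inK? ∩? sq?)) (count (outK? ∩? sq?)) (count (_∈? B))
               Pairs.count-reps-≤ count-class-reps-≤ count-inK-≤ count-inK+outK ⟩
    11 * (2 * count (_∈? B)) + 24 * (count (inK? ∩? sq?) + count (outK? ∩? sq?))
      ≡⟨ cong₂ (λ m a → 11 * m + 24 * a) (trans (cong (2 *_) (sym (∣∣≡count B))) index) (sym count-A₂∖B) ⟩
    11 * n + 24 * ∣ A₂∖ G B ∣                         ∎
    where open ≤-Reasoning

  module _ {S : Subset n} (S-counted : Counted G B H K S) where

    S-symmetric : ∀ {x} → x ∈ S → x ⁻¹ ∈ S
    S-symmetric {x} = proj₁ (proj₁ (proj₂ S-counted)) x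

    S-∙-closed : ∀ {x h} → x ∈ S → x ∉ K → h ∈ H → x ∙ h ∈ S
    S-∙-closed {x} {h} x∈S x∉K h∈H =
      let (_ , S∖K≡T·H) = proj₂ (proj₂ S-counted)
          (t , h₀ , t∈T , h₀∈H , x≡th₀) = Equivalence.to (S∖K≡T·H x) (x∈S , x∉K)
      in proj₁ (Equivalence.from (S∖K≡T·H (x ∙ h))
           (t , h₀ ∙ h , t∈T , H.∙-closed h₀∈H h∈H , trans (cong (_∙ h) x≡th₀) (assoc t h₀ h)))

    inK-saturated : Pairs.Saturated (λ x → InK x × x ∈ S)
    inK-saturated = Pairs.inverse-closed-saturated
      λ ((x∈K , x∉B) , x∈S) → (K.⁻¹-closed x∈K , B.∉-⁻¹ x∉B) , S-symmetric x∈S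

    outK-saturated′ : Classes.Saturated (λ x → OutK x × x ∈ S)
    outK-saturated′ =
        (λ (Ox@(_ , x∉K) , x∈S) h∈H → proj₁ Classes.outK-saturated Ox h∈H , S-∙-closed x∈S x∉K h∈H)
      , (λ (Ox , x∈S) → proj₂ Classes.outK-saturated Ox , S-symmetric x∈S)

  counted-determined : ∀ {S S′} → Counted G B H K S → Counted G B H K S′ →
    (∀ {r} → Reps r → r ∈ S → r ∈ S′) → S ⊆ S′
  counted-determined {S} {S′} S-counted S′-counted agree {x} x∈S with x ∈? K
  ... | yes x∈K = Pairs.agree-on-reps (inK-saturated S-counted) (inK-saturated S′-counted)
                    (agree ∘ inj₁) (x∈K , proj₁ S-counted x x∈S) x∈S
  ... | no x∉K  = Classes.agree-on-reps (outK-saturated′ S-counted) (outK-saturated′ S′-counted)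
                    (agree ∘ inj₂) (proj₁ S-counted x x∈S , x∉K) x∈S

  length-≤-2^count-reps : {L : List (Subset n)} → Unique L → All (Counted G B H K) L → length L ≤ 2 ^ count reps?
  length-≤-2^count-reps u counted-L = length-≤-2^-of-determined (filter reps? (allFin n)) u λ S∈ S′∈ agree →
    counted-determined (All.lookup counted-L S∈) (All.lookup counted-L S′∈) (agree ∘ ∈-count⁺ reps?)

lemma4p5 : (n : ℕ) (G : FinAbGroup n) →
    ¬ (∃[ k ] (n ≡ 2 ^ k)) →
    (B H K : Subset n) →
    IsSubgroup G B → 2 * ∣ B ∣ ≡ n →
    IsSubgroup G H → IsSubgroup G K →
    1 < ∣ H ∣ → H ⊆ K → ∣ K ∣ < n → H ⊆ B →
    (L : List (Subset n)) → Unique L → All (Counted G B H K) L →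
    length L ^ 48 ≤ 2 ^ (11 * n + 24 * ∣ A₂∖ G B ∣)
lemma4p5 n G n≢2^k B H K B-sub index H-sub K-sub H-nontrivial H⊆K K-proper H⊆B L unique-L counted-L = begin
  length L ^ 48           ≤⟨ ^-monoˡ-≤ 48 (length-≤-2^count-reps unique-L counted-L) ⟩
  (2 ^ count reps?) ^ 48  ≡⟨ ^-*-assoc 2 (count reps?) 48 ⟩
  2 ^ (count reps? * 48)
    ≤⟨ ^-monoʳ-≤ 2 (subst (_≤ 11 * n + 24 * ∣ A₂∖ G B ∣) (*-comm 48 (count reps?)) 48*-count-reps-≤) ⟩
  2 ^ (11 * n + 24 * ∣ A₂∖ G B ∣) ∎
  where
  open ≤-Reasoning
  open Setting G n≢2^k B H K B-sub index H-sub K-sub H-nontrivial H⊆K K-proper H⊆B
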